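{- Let $G$ and $H$ be $r$-graphs with $|V(H)|=h$ and $s(H)=s\geq 2$. If $G$ is $T_{r,h,s}$-template saturated, then $G$ is weakly $H$-saturated.
   Context: An $r$-graph is a pair $(V,E)$ with $E\subseteq\binom{V}{r}$ (the $r$-element subsets of $V$). The sparseness $s(H)$ of an $r$-graph $H$ with at least one edge is the smallest size of a vertex set $W\subseteq V(H)$ contained in precisely one edge of $H$. For integers $s\leq r\leq h$, $T^-_{r,h,s}$ is the $r$-graph obtained from the complete $r$-graph $K^r_h$ on $h$ vertices by choosing a set $Z$ of $s$ vertices and deleting all edges containing $Z$; the template $r$-graph $T_{r,h,s}$ is obtained from $T^-_{r,h,s}$ by adding one missing edge $f$ (on the same vertex set), called the special edge (this is unique up to isomorphism). An $r$-graph $G=(V,E)$ is $T_{r,h,s}$-template saturated (in $\binom{V}{r}$) if the elements of $\binom{V}{r}\setminus E$ admit an ordering $e_1,\dots,e_k$ such that for each $i$ the $r$-graph $G\cup\{e_1,\dots,e_i\}$ contains a copy (subgraph isomorphic to) $T_{r,h,s}$ in which $e_i$ plays the role of the special edge. $G=(V,E)$ is weakly $H$-saturated if the elements of $\binom{V}{r}\setminus E$ admit an ordering $e_1,\dots,e_k$ such that for each $i$ the $r$-graph $G\cup\{e_1,\dots,e_i\}$ contains a copy of $H$ containing $e_i$. -}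

module Defs where

open import Data.Nat using (ℕ; suc; _≤_)
open import Data.Fin using (Fin; toℕ)
open import Data.Fin.Subset using (Subset; _∈_; _∉_; _⊆_; ∣_∣)
open import Data.List using (List; length; take; lookup)
import Data.List.Membership.Propositional as L
open import Data.List.Relation.Unary.Unique.Propositional using (Unique)
open import Data.Product using (Σ; ∃; ∃-syntax; _×_; _,_)
open import Data.Sum using (_⊎_)
open import Relation.Nullary using (¬_)
open import Relation.Binary.PropositionalEquality using (_≡_)
open import Function.Definitions using (Injective)
open import Function.Bundles using (_⇔_)

record RGraph (r n : ℕ) : Set₁ where
  field
    Edge     : Subset n → Set
    edgeSize : ∀ e → Edge e → ∣ e ∣ ≡ r
open RGraph public

InExactlyOneEdge : ∀ {r n} → RGraph r n → Subset n → Set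
InExactlyOneEdge H W =
  ∃[ e ] (Edge H e × W ⊆ e × (∀ e′ → Edge H e′ → W ⊆ e′ → e′ ≡ e))

Sparseness : ∀ {r n} → RGraph r n → ℕ → Set
Sparseness H s =
  (∃[ W ] (InExactlyOneEdge H W × ∣ W ∣ ≡ s))
  × (∀ W → InExactlyOneEdge H W → s ≤ ∣ W ∣)

MapsOnto : ∀ {h n} → (Fin h → Fin n) → Subset h → Subset n → Set
MapsOnto {h} φ e f = ∀ x → (x ∈ f) ⇔ (∃[ y ] (y ∈ e × φ y ≡ x))

IsCopy : ∀ {r h n} → RGraph r h → (Subset n → Set) → (Fin h → Fin n) → Set
IsCopy H E φ =
  Injective _≡_ _≡_ φ × (∀ e → Edge H e → ∃[ f ] (E f × MapsOnto φ e f))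

-- Template r-graph T_{r,h,s} on Fin h, given the s-set Z and the special edge f
-- (an r-set containing Z): all r-sets not containing Z, plus f.
Template : (r h : ℕ) → (Z f : Subset h) → ∣ f ∣ ≡ r → RGraph r h
Template r h Z f fr = record
  { Edge     = λ e → (∣ e ∣ ≡ r × ¬ (Z ⊆ e)) ⊎ (e ≡ f)
  ; edgeSize = size }
  where
  size : ∀ e → ((∣ e ∣ ≡ r × ¬ (Z ⊆ e)) ⊎ (e ≡ f)) → ∣ e ∣ ≡ r
  size e (Data.Sum.inj₁ (p , _)) = p
  size e (Data.Sum.inj₂ Relation.Binary.PropositionalEquality.refl) = fr

IsNonEdgeOrdering : ∀ {r n} → RGraph r n → List (Subset n) → Set
IsNonEdgeOrdering {r} G es =
  Unique es × (∀ e → (e L.∈ es) ⇔ (∣ e ∣ ≡ r × ¬ Edge G e))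

Extend : ∀ {r n} → RGraph r n → List (Subset n) → ℕ → Subset n → Set
Extend G es i e = Edge G e ⊎ (e L.∈ take i es)

TemplateSaturated : (r h s : ℕ) → ∀ {n} → RGraph r n → Set
TemplateSaturated r h s {n} G =
  ∃[ es ] (IsNonEdgeOrdering G es ×
    ((i : Fin (length es)) →
      ∃[ Z ] ∃[ f ] Σ (∣ f ∣ ≡ r) λ fr →
        ∣ Z ∣ ≡ s × Z ⊆ f ×
        ∃[ φ ] (IsCopy (Template r h Z f fr) (Extend G es (suc (toℕ i))) φ
                × MapsOnto φ f (lookup es i))))

WeaklySaturated : ∀ {r h n} → RGraph r h → RGraph r n → Set
WeaklySaturated H G =
  ∃[ es ] (IsNonEdgeOrdering G es ×
    ((i : Fin (length es)) →
      ∃[ φ ] (IsCopy H (Extend G es (suc (toℕ i))) φ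
              × ∃[ e ] (Edge H e × MapsOnto φ e (lookup es i)))))

-- Let W be a set of s vertices lying in exactly one edge e₀ of H. In each step the template
-- copy has its s-set Z inside its special edge f. Colour every vertex by its membership in
-- (W, e₀), resp. (Z, f): nestedness and |W| = |Z|, |e₀| = |f| force equal colour classes, so a
-- permutation π of V(H) carries W onto Z and e₀ onto f. Then π sends e₀ to the special edge and
-- every other edge of H to an r-set not containing Z (it would otherwise contain W), i.e. to an
-- edge of the template; composing with the template copy embeds H with e₀ on the new edge.

module Submission where

open import Defs
open import Data.Nat using (ℕ; _≤_; zero; suc; _+_; s≤s; z≤n)
open import Data.Nat.Properties using (+-0-commutativeMonoid; +-cancelˡ-≡; +-cancelʳ-≡)
open import Data.Bool using (Bool; true; false)
import Data.Bool.Properties as Bool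
open import Data.Fin using (Fin; punchIn; toℕ)
open import Data.Fin.Subset using (Subset; _∈_; _⊆_; ∣_∣)
open import Data.Fin.Permutation as Perm using (Permutation; _⟨$⟩ʳ_; _⟨$⟩ˡ_; insert; inverseˡ; inverseʳ; insert-punchIn)
open import Data.Vec using ([]; _∷_; lookup; tabulate)
open import Data.Vec.Properties using ([]=⇒lookup; lookup⇒[]=; lookup∘tabulate; ≡-dec)
import Data.List as List
open import Data.Product using (∃-syntax; _×_; _,_; proj₁; proj₂)
import Data.Product.Properties as Product
open import Data.Sum using (inj₁; inj₂)
open import Relation.Nullary using (¬_; yes; no; contradiction)
open import Relation.Binary.Definitions using (DecidableEquality)
open import Relation.Binary.PropositionalEquality
open import Function.Base using (_∘_)
open import Function.Bundles using (mk⇔; module Equivalence; module Injection)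
open import Function.Properties.Inverse using (↔⇒↣)
import Function.Construct.Composition as Compose
open import Algebra.Properties.CommutativeMonoid.Sum +-0-commutativeMonoid
  using (sum; sum-remove; sum-cong-≗; sum-permute; ∑-distrib-+; sum-replicate-zero)

private variable
  h n : ℕ

module Colouring {a} {A : Set a} (_≟_ : DecidableEquality A) where

  δ : A → A → ℕ
  δ c x with c ≟ x
  ... | yes _ = 1
  ... | no _  = 0

  δ-refl : ∀ c → δ c c ≡ 1
  δ-refl c with c ≟ c
  ... | yes _   = refl
  ... | no c≢c = contradiction refl c≢c

  classSize : A → (Fin h → A) → ℕ
  classSize c u = sum (δ c ∘ u)

  classSize-pos⇒∃ : ∀ (u : Fin h → A) c → 1 ≤ classSize c u → ∃[ j ] u j ≡ c
  classSize-pos⇒∃ {suc h} u c p with c ≟ u Fin.zero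
  ... | yes c≡u₀ = Fin.zero , sym c≡u₀
  ... | no _ with classSize-pos⇒∃ (u ∘ Fin.suc) c p
  ...   | j , uj≡c = Fin.suc j , uj≡c

  classSizes-≡⇒permutation : ∀ (u v : Fin h → A) → (∀ c → classSize c u ≡ classSize c v) →
                             ∃[ π ] ∀ i → u i ≡ v (π ⟨$⟩ʳ i)
  classSizes-≡⇒permutation {zero}  u v _ = Perm.id , λ ()
  classSizes-≡⇒permutation {suc h} u v same = π , u≡v∘π
    where
    u₀ = u Fin.zero
    v-hits-u₀ : ∃[ j ] v j ≡ u₀
    v-hits-u₀ = classSize-pos⇒∃ v u₀ (subst (1 ≤_) (same u₀) u₀∈u)
      where
      u₀∈u : 1 ≤ classSize u₀ u
      u₀∈u rewrite δ-refl u₀ = s≤s z≤n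
    j = proj₁ v-hits-u₀
    same-rest : ∀ c → classSize c (u ∘ Fin.suc) ≡ classSize c (v ∘ punchIn j)
    same-rest c = +-cancelˡ-≡ (δ c u₀) _ _ (begin
      δ c u₀ + classSize c (u ∘ Fin.suc)   ≡⟨ same c ⟩
      classSize c v                        ≡⟨ sum-remove (δ c ∘ v) ⟩
      δ c (v j) + classSize c (v ∘ punchIn j) ≡⟨ cong (λ x → δ c x + classSize c (v ∘ punchIn j)) (proj₂ v-hits-u₀) ⟩
      δ c u₀ + classSize c (v ∘ punchIn j) ∎)
      where open ≡-Reasoning
    rest = classSizes-≡⇒permutation (u ∘ Fin.suc) (v ∘ punchIn j) same-rest
    π = insert Fin.zero j (proj₁ rest)
    u≡v∘π : ∀ i → u i ≡ v (π ⟨$⟩ʳ i)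
    u≡v∘π Fin.zero    = sym (proj₂ v-hits-u₀)
    u≡v∘π (Fin.suc k) = trans (proj₂ rest k) (cong v (sym (insert-punchIn Fin.zero j (proj₁ rest) k)))

indicator : Bool → ℕ
indicator true  = 1
indicator false = 0

∣p∣≡∑indicator : (p : Subset h) → ∣ p ∣ ≡ sum (indicator ∘ lookup p)
∣p∣≡∑indicator []          = refl
∣p∣≡∑indicator (true ∷ p)  = cong suc (∣p∣≡∑indicator p)
∣p∣≡∑indicator (false ∷ p) = ∣p∣≡∑indicator p

sum-split : (f g k : Fin h → ℕ) → (∀ i → f i ≡ g i + k i) → sum f ≡ sum g + sum k
sum-split f g k f≗g+k = trans (sum-cong-≗ f≗g+k) (∑-distrib-+ g k)

cancel-tallies : ∀ {t f u v t′ f′ u′ v′ : ℕ} → f ≡ f′ → t + f ≡ t′ + f′ → t + u ≡ t′ + u′ →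
                 (t + f) + (u + v) ≡ (t′ + f′) + (u′ + v′) → t ≡ t′ × u ≡ u′ × v ≡ v′
cancel-tallies {t} {f} {u} {t′ = t′} refl eq₁ eq₂ eq₃ with +-cancelʳ-≡ f t t′ eq₁
... | refl with +-cancelˡ-≡ t _ _ eq₂
...   | refl = refl , refl , +-cancelˡ-≡ u _ _ (+-cancelˡ-≡ (t + f) _ _ eq₃)

open Colouring (Product.≡-dec Bool._≟_ Bool._≟_)

profile : Subset h → Subset h → Fin h → Bool × Bool
profile W A y = lookup W y , lookup A y

module _ (w : Fin h → Bool × Bool) where

  ∑indicator₁ : sum (indicator ∘ proj₁ ∘ w) ≡ classSize (true , true) w + classSize (true , false) w
  ∑indicator₁ = sum-split _ _ _ (λ i → split (w i))
    where
    split : ∀ x → indicator (proj₁ x) ≡ δ (true , true) x + δ (true , false) x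
    split (true , true)   = refl
    split (true , false)  = refl
    split (false , true)  = refl
    split (false , false) = refl

  ∑indicator₂ : sum (indicator ∘ proj₂ ∘ w) ≡ classSize (true , true) w + classSize (false , true) w
  ∑indicator₂ = sum-split _ _ _ (λ i → split (w i))
    where
    split : ∀ x → indicator (proj₂ x) ≡ δ (true , true) x + δ (false , true) x
    split (true , true)   = refl
    split (true , false)  = refl
    split (false , true)  = refl
    split (false , false) = refl

  ∑1 : sum {h} (λ _ → 1) ≡ (classSize (true , true) w + classSize (true , false) w)
                          + (classSize (false , true) w + classSize (false , false) w)
  ∑1 = trans (sum-split _ (λ i → in₁ (w i)) (λ i → out₁ (w i)) (split ∘ w))
             (cong₂ _+_ (∑-distrib-+ (δ (true , true) ∘ w) (δ (true , false) ∘ w))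
                        (∑-distrib-+ (δ (false , true) ∘ w) (δ (false , false) ∘ w)))
    where
    in₁ out₁ : Bool × Bool → ℕ
    in₁ x  = δ (true , true) x + δ (true , false) x
    out₁ x = δ (false , true) x + δ (false , false) x
    split : ∀ x → 1 ≡ in₁ x + out₁ x
    split (true , true)   = refl
    split (true , false)  = refl
    split (false , true)  = refl
    split (false , false) = refl

⊆⇒classSize[true,false]≡0 : {W A : Subset h} → W ⊆ A → classSize (true , false) (profile W A) ≡ 0
⊆⇒classSize[true,false]≡0 {h} {W} {A} W⊆A = trans (sum-cong-≗ pointwise) (sum-replicate-zero h)
  where
  pointwise : ∀ y → δ (true , false) (profile W A y) ≡ 0
  pointwise y with lookup W y in Wy
  ... | false = lemma (lookup A y)
    where
    lemma : ∀ b → δ (true , false) (false , b) ≡ 0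
    lemma true  = refl
    lemma false = refl
  ... | true rewrite []=⇒lookup (W⊆A (lookup⇒[]= y W Wy)) = refl

nested-classSizes : {W A Z B : Subset h} → W ⊆ A → Z ⊆ B → ∣ W ∣ ≡ ∣ Z ∣ → ∣ A ∣ ≡ ∣ B ∣ →
                    ∀ c → classSize c (profile W A) ≡ classSize c (profile Z B)
nested-classSizes {W = W} {A} {Z} {B} W⊆A Z⊆B ∣W∣≡∣Z∣ ∣A∣≡∣B∣ = same
  where
  w  = profile W A
  w′ = profile Z B
  same-TF : classSize (true , false) w ≡ classSize (true , false) w′
  same-TF = trans (⊆⇒classSize[true,false]≡0 W⊆A) (sym (⊆⇒classSize[true,false]≡0 Z⊆B))
  tallies = cancel-tallies same-TF
    (trans (sym (trans (∣p∣≡∑indicator W) (∑indicator₁ w)))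
           (trans ∣W∣≡∣Z∣ (trans (∣p∣≡∑indicator Z) (∑indicator₁ w′))))
    (trans (sym (trans (∣p∣≡∑indicator A) (∑indicator₂ w)))
           (trans ∣A∣≡∣B∣ (trans (∣p∣≡∑indicator B) (∑indicator₂ w′))))
    (trans (sym (∑1 w)) (∑1 w′))
  same : ∀ c → classSize c w ≡ classSize c w′
  same (true , true)   = proj₁ tallies
  same (true , false)  = same-TF
  same (false , true)  = proj₁ (proj₂ tallies)
  same (false , false) = proj₂ (proj₂ tallies)

record Relabels (π : Permutation h h) (e g : Subset h) : Set where
  constructor relabels
  field relabel : ∀ y → lookup e y ≡ lookup g (π ⟨$⟩ʳ y)
open Relabels

nested-relabelling : {W A Z B : Subset h} → W ⊆ A → Z ⊆ B → ∣ W ∣ ≡ ∣ Z ∣ → ∣ A ∣ ≡ ∣ B ∣ →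
                     ∃[ π ] Relabels π W Z × Relabels π A B
nested-relabelling {W = W} {A} {Z} {B} W⊆A Z⊆B ∣W∣≡∣Z∣ ∣A∣≡∣B∣
  with classSizes-≡⇒permutation (profile W A) (profile Z B) (nested-classSizes W⊆A Z⊆B ∣W∣≡∣Z∣ ∣A∣≡∣B∣)
... | π , same-profile = π , relabels (cong proj₁ ∘ same-profile) , relabels (cong proj₂ ∘ same-profile)

image : Permutation h h → Subset h → Subset h
image π e = tabulate (lookup e ∘ (π ⟨$⟩ˡ_))

relabels-image : (π : Permutation h h) (e : Subset h) → Relabels π e (image π e)
relabels-image π e = relabels λ y → sym (trans (lookup∘tabulate (lookup e ∘ (π ⟨$⟩ˡ_)) (π ⟨$⟩ʳ y)) (cong (lookup e) (inverseˡ π)))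

Relabels⇒∣≡∣ : {π : Permutation h h} {e g : Subset h} → Relabels π e g → ∣ e ∣ ≡ ∣ g ∣
Relabels⇒∣≡∣ {π = π} {e} {g} e↦g = begin
  ∣ e ∣                                  ≡⟨ ∣p∣≡∑indicator e ⟩
  sum (indicator ∘ lookup e)             ≡⟨ sum-cong-≗ (cong indicator ∘ relabel e↦g) ⟩
  sum (indicator ∘ lookup g ∘ (π ⟨$⟩ʳ_)) ≡⟨ sum-permute (indicator ∘ lookup g) π ⟨
  sum (indicator ∘ lookup g)             ≡⟨ ∣p∣≡∑indicator g ⟨
  ∣ g ∣                                  ∎
  where open ≡-Reasoning

Relabels-⊆ : {π : Permutation h h} {W e Z g : Subset h} → Relabels π W Z → Relabels π e g → Z ⊆ g → W ⊆ e
Relabels-⊆ {π = π} {e = e} {Z} W↦Z e↦g Z⊆g {y} y∈W =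
  lookup⇒[]= y e (trans (relabel e↦g y) ([]=⇒lookup (Z⊆g πy∈Z)))
  where
  πy∈Z : π ⟨$⟩ʳ y ∈ Z
  πy∈Z = lookup⇒[]= (π ⟨$⟩ʳ y) Z (trans (sym (relabel W↦Z y)) ([]=⇒lookup y∈W))

Relabels⇒MapsOnto : {π : Permutation h h} {e g : Subset h} → Relabels π e g → MapsOnto (π ⟨$⟩ʳ_) e g
Relabels⇒MapsOnto {π = π} {e} {g} e↦g x = mk⇔ to from
  where
  to : x ∈ g → ∃[ y ] (y ∈ e × π ⟨$⟩ʳ y ≡ x)
  to x∈g = π ⟨$⟩ˡ x , lookup⇒[]= _ e (trans (relabel e↦g _) (trans (cong (lookup g) (inverseʳ π)) ([]=⇒lookup x∈g))) , inverseʳ π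
  from : ∃[ y ] (y ∈ e × π ⟨$⟩ʳ y ≡ x) → x ∈ g
  from (y , y∈e , refl) = lookup⇒[]= _ g (trans (sym (relabel e↦g y)) ([]=⇒lookup y∈e))

MapsOnto-∘ : {σ : Fin h → Fin h} {φ : Fin h → Fin n} {e g : Subset h} {F : Subset n} →
             MapsOnto σ e g → MapsOnto φ g F → MapsOnto (φ ∘ σ) e F
MapsOnto-∘ {σ = σ} {φ} {e} {F = F} e↦g g↦F x = mk⇔ to from
  where
  to : x ∈ F → ∃[ y ] (y ∈ e × φ (σ y) ≡ x)
  to x∈F with Equivalence.to (g↦F x) x∈F
  ... | z , z∈g , refl with Equivalence.to (e↦g z) z∈g
  ...   | y , y∈e , refl = y , y∈e , refl
  from : ∃[ y ] (y ∈ e × φ (σ y) ≡ x) → x ∈ F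
  from (y , y∈e , refl) = Equivalence.from (g↦F x) (σ y , Equivalence.from (e↦g (σ y)) (y , y∈e , refl) , refl)

template-copy⇒copy : ∀ {r} (H : RGraph r h) {W e₀ Z f : Subset h} (fr : ∣ f ∣ ≡ r)
                     {E : Subset n → Set} {φ : Fin h → Fin n} (π : Permutation h h) →
                     (∀ e → Edge H e → W ⊆ e → e ≡ e₀) → Relabels π W Z → Relabels π e₀ f →
                     IsCopy (Template r h Z f fr) E φ → IsCopy H E (φ ∘ (π ⟨$⟩ʳ_))
template-copy⇒copy H {e₀ = e₀} {Z} {f} fr {E} {φ} π W-unique W↦Z e₀↦f (φ-injective , φ-copy) =
  Compose.injective _≡_ _≡_ _≡_ (Injection.injective (↔⇒↣ π)) φ-injective , copy
  where
  through : ∀ {e} g → Edge (Template _ _ Z f fr) g → Relabels π e g → ∃[ F ] (E F × MapsOnto (φ ∘ (π ⟨$⟩ʳ_)) e F)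
  through g Tg e↦g with φ-copy g Tg
  ... | F , EF , g↦F = F , EF , MapsOnto-∘ (Relabels⇒MapsOnto e↦g) g↦F

  copy : ∀ e → Edge H e → ∃[ F ] (E F × MapsOnto (φ ∘ (π ⟨$⟩ʳ_)) e F)
  copy e He with ≡-dec Bool._≟_ e e₀
  ... | yes refl = through f (inj₂ refl) e₀↦f
  ... | no e≢e₀  = through (image π e) (inj₁ (∣πe∣≡r , Z⊈πe)) e↦πe
    where
    e↦πe = relabels-image π e
    ∣πe∣≡r = trans (sym (Relabels⇒∣≡∣ e↦πe)) (edgeSize H e He)
    Z⊈πe : ¬ (Z ⊆ image π e)
    Z⊈πe Z⊆πe = e≢e₀ (W-unique e He (Relabels-⊆ W↦Z e↦πe Z⊆πe))

lemma2p1 : (r h n s : ℕ) (G : RGraph r n) (H : RGraph r h) →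
    Sparseness H s → 2 ≤ s →
    TemplateSaturated r h s G → WeaklySaturated H G
lemma2p1 r h n s G H ((W , (e₀ , He₀ , W⊆e₀ , W-unique) , ∣W∣≡s) , _) _ (es , nonEdges , template) =
  es , nonEdges , step
  where
  step : (i : Fin (List.length es)) →
         ∃[ φ ] (IsCopy H (Extend G es (suc (toℕ i))) φ × ∃[ e ] (Edge H e × MapsOnto φ e (List.lookup es i)))
  step i with template i
  ... | Z , f , fr , ∣Z∣≡s , Z⊆f , φ , φ-copy , f↦eᵢ
    with nested-relabelling W⊆e₀ Z⊆f (trans ∣W∣≡s (sym ∣Z∣≡s)) (trans (edgeSize H e₀ He₀) (sym fr))
  ... | π , W↦Z , e₀↦f =
    φ ∘ (π ⟨$⟩ʳ_) , template-copy⇒copy H fr π W-unique W↦Z e₀↦f φ-copy ,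
    e₀ , He₀ , MapsOnto-∘ (Relabels⇒MapsOnto e₀↦f) f↦eᵢ
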